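{- For any $n\geq1$ and $k\geq0$, the number of permutations $\pi\in\mathfrak{S}_{n}$ with $\mathrm{udr}(\pi)=k$ and $\mathrm{ipk}(\pi)=0$ is equal to $\binom{n-1}{k-1}$ (interpreted as $0$ when $k=0$).
   Context: $\mathfrak{S}_n$ is the symmetric group on $[n]$. For $\pi\in\mathfrak{S}_n$, $i$ with $2\le i\le n-1$ is a peak if $\pi(i-1)<\pi(i)>\pi(i+1)$, $\mathrm{pk}(\pi)$ is the number of peaks, and $\mathrm{ipk}(\pi)=\mathrm{pk}(\pi^{ -1})$. A birun of $\pi$ (in one-line notation) is a maximal monotone consecutive subsequence; an up-down run is a birun or the one-element subsequence $\pi(1)$ when $\pi(1)>\pi(2)$; $\mathrm{udr}(\pi)$ is the number of up-down runs (for $n=1$, $\mathrm{udr}=1$). -}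

module Defs where

open import Data.Nat using (ℕ; zero; suc; _+_; _∸_; _<ᵇ_)
open import Data.Nat.Combinatorics using (_C_)
open import Data.Bool using (Bool; true; false; if_then_else_; _∧_; _∨_; T)
open import Data.Fin using (Fin; toℕ)
open import Data.Vec using (Vec; toList)
import Data.Vec as Vec
open import Data.List using (List; []; _∷_; map; upTo)
open import Data.List.Relation.Unary.Unique.Propositional using (Unique)
open import Data.List.Relation.Unary.Unique.DecPropositional using (unique?)
open import Data.Fin.Properties using () renaming (_≟_ to _≟F_)
open import Relation.Nullary.Decidable using (⌊_⌋)
open import Data.Nat using (_≡ᵇ_)

-- One-line notation of a candidate permutation of [n]: a vector of length n
-- with entries in Fin n (value j : Fin n stands for j+1 ∈ [n]).
isPerm : ∀ {n} → Vec (Fin n) n → Bool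
isPerm v = ⌊ unique? _≟F_ (toList v) ⌋

word : ∀ {n} → Vec (Fin n) n → List ℕ
word v = toList (Vec.map toℕ v)

-- position (0-based) of value j in a word (length of word if absent)
pos : ℕ → List ℕ → ℕ
pos j []      = 0
pos j (x ∷ l) = if x ≡ᵇ j then 0 else suc (pos j l)

invWord : ℕ → List ℕ → List ℕ
invWord n l = map (λ j → pos j l) (upTo n)

b2n : Bool → ℕ
b2n true  = 1
b2n false = 0

pkW : List ℕ → ℕ
pkW (a ∷ b ∷ c ∷ r) = b2n ((a <ᵇ b) ∧ (c <ᵇ b)) + pkW (b ∷ c ∷ r)
pkW _               = 0

turnW : List ℕ → ℕ
turnW (a ∷ b ∷ c ∷ r) =
  b2n (((a <ᵇ b) ∧ (c <ᵇ b)) ∨ ((b <ᵇ a) ∧ (b <ᵇ c))) + turnW (b ∷ c ∷ r)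
turnW _               = 0

-- number of biruns (maximal monotone consecutive subsequences) of a word of
-- length ≥ 2 with distinct letters: consecutive biruns share an endpoint, which
-- is an interior peak or valley, so the count is 1 + #turning points.
birunsW : List ℕ → ℕ
birunsW l = suc (turnW l)

-- up-down runs: biruns, plus the singleton π(1) when π(1) > π(2); udr = 1 for n = 1
udrW : List ℕ → ℕ
udrW []            = 0
udrW (a ∷ [])      = 1
udrW (a ∷ b ∷ r)   = b2n (b <ᵇ a) + birunsW (a ∷ b ∷ r)

pk : ∀ {n} → Vec (Fin n) n → ℕ
pk v = pkW (word v)

ipk : ∀ {n} → Vec (Fin n) n → ℕ
ipk {n} v = pkW (invWord n (word v))

udr : ∀ {n} → Vec (Fin n) n → ℕ
udr v = udrW (word v)

binomPrev : ℕ → ℕ → ℕ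
binomPrev n zero    = 0
binomPrev n (suc k) = (n ∸ 1) C k

Counted : ℕ → ℕ → Set
Counted n k = Data.Product.Σ (Vec (Fin n) n)
  (λ v → T (isPerm v ∧ (udr v ≡ᵇ k) ∧ (ipk v ≡ᵇ 0)))
  where import Data.Product

{-# OPTIONS --safe #-}
-- π⁻¹ has no peak iff the positions of 1, 2, …, n in π first decrease and then
-- increase, i.e. iff the last letter of π is its least or its greatest letter and
-- π without that letter has the same property.  Such π are exactly the words grown
-- from the word 1 by appending a new minimum or a new maximum at each step, so π is
-- determined by its word of ascents and descents, which is arbitrary in {↑,↓}ⁿ⁻¹.
-- udr π is one more than the number of switches in that word when it is preceded
-- by a virtual ascent, and by Pascal's rule words of length n - 1 with k - 1
-- switches are counted by C(n-1, k-1).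
module Submission where

open import Defs
open import Data.Nat using (ℕ; _≤_)
open import Data.Fin using (Fin)
open import Function.Bundles using (_↔_)

open import Data.Bool using (Bool; true; false; not; _∧_; _∨_; _xor_; T)
open import Data.Bool.Properties using (T-∧; T-irrelevant; ∧-zeroʳ)
open import Data.Empty using (⊥-elim)
open import Data.Fin as Fin using (toℕ; fromℕ<; punchOut)
open import Data.Fin.Properties
  using (toℕ-injective; toℕ<n; toℕ-fromℕ<; punchOut-injective; injective⇒≤; +↔⊎; 0↔⊥)
open import Data.List
  using (List; []; _∷_; _∷ʳ_; map; length; reverse; applyUpTo; initLast; _∷ʳ′_)
open import Data.List.Properties
  using ( length-++; length-map; length-reverse; map-injective; map-upTo; applyUpTo-∷ʳ
        ; reverse-++; unfold-reverse; reverse-involutive)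
open import Data.List.Membership.Propositional using (_∈_; _∉_)
open import Data.List.Membership.Propositional.Properties using (∈-map⁺; ∈-map⁻; ∈-++⁻; ∈-++⁺ˡ; ∈-++⁺ʳ)
open import Data.List.Relation.Unary.All using (All; []; _∷_)
import Data.List.Relation.Unary.All as All
import Data.List.Relation.Unary.All.Properties as All
open import Data.List.Relation.Unary.Any using (here; there)
open import Data.List.Relation.Unary.Unique.Propositional using (Unique; []; _∷_)
import Data.List.Relation.Unary.Unique.Propositional.Properties as Unique
open import Data.Nat using (zero; suc; pred; _<_; _+_; _<ᵇ_; _≡ᵇ_; s≤s; z<s; s<s; s≤s⁻¹; s<s⁻¹)
open import Data.Nat.Combinatorics using (_C_; nCk+nC[k+1]≡[n+1]C[k+1])
open import Data.Nat.Properties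
  using ( _≟_; suc-injective; ≡-irrelevant; ≡ᵇ⇒≡; ≡⇒≡ᵇ; +-suc; +-comm; m+n≡0⇒n≡0
        ; <-cmp; <⇒≤; <⇒≢; <-trans; <-irrefl; n<1+n; 1+n≢n; 1+n≰n; ≤∧≢⇒<; m<1+n⇒m<n∨m≡n)
open import Data.Product using (Σ; _×_; _,_; proj₁; proj₂)
open import Data.Sum using (_⊎_; inj₁; inj₂)
open import Data.Sum.Function.Propositional using (_⊎-↔_)
open import Data.Vec using (Vec; toList; lookup)
import Data.Vec as Vec
open import Data.Vec.Properties using (cast-is-id; toList-map; toList-injective; length-toList)
open import Data.Vec.Membership.Propositional using () renaming (_∈_ to _∈ᵥ_)
open import Data.Vec.Membership.Propositional.Properties using (∈-lookup; ∈-toList⁺)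
open import Data.Vec.Relation.Unary.Any using (any?)
import Data.Vec.Relation.Unary.All.Properties as VecAll
import Data.Vec.Relation.Unary.Unique.Propositional as VecUnique
open import Data.Vec.Relation.Unary.Unique.Propositional.Properties using (lookup-injective)
open import Function using (_∘_; _$_)
open import Function.Bundles using (Equivalence; _⇔_; mk⇔; mk↔ₛ′)
open import Function.Definitions using (Injective)
open import Function.Properties.Inverse using (↔-trans; ↔-sym)
open import Relation.Binary.Definitions using (tri<; tri≈; tri>)
open import Relation.Binary.PropositionalEquality
open import Relation.Nullary using (¬_; yes; no; contradiction)
open import Relation.Nullary.Decidable using (toWitness; fromWitness)

<ᵇ≡true : ∀ {m n} → m < n → (m <ᵇ n) ≡ true
<ᵇ≡true {zero}  {suc n} _         = refl
<ᵇ≡true {suc m} {suc n} (s<s m<n) = <ᵇ≡true m<n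

<ᵇ≡false : ∀ {m n} → n ≤ m → (m <ᵇ n) ≡ false
<ᵇ≡false {m}     {zero}  _         = refl
<ᵇ≡false {suc m} {suc n} (s≤s n≤m) = <ᵇ≡false n≤m

<ᵇ-flip : ∀ {m n} → m ≢ n → (n <ᵇ m) ≡ not (m <ᵇ n)
<ᵇ-flip {m} {n} m≢n with <-cmp m n
... | tri< m<n _ _ rewrite <ᵇ≡true m<n | <ᵇ≡false (<⇒≤ m<n) = refl
... | tri≈ _ m≡n _ = contradiction m≡n m≢n
... | tri> _ _ n<m rewrite <ᵇ≡true n<m | <ᵇ≡false (<⇒≤ n<m) = refl

≡ᵇ≡true : ∀ m → (m ≡ᵇ m) ≡ true
≡ᵇ≡true zero    = refl
≡ᵇ≡true (suc m) = ≡ᵇ≡true m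

≡ᵇ≡false : ∀ {m n} → m ≢ n → (m ≡ᵇ n) ≡ false
≡ᵇ≡false {zero}  {zero}  m≢n = contradiction refl m≢n
≡ᵇ≡false {zero}  {suc n} _   = refl
≡ᵇ≡false {suc m} {zero}  _   = refl
≡ᵇ≡false {suc m} {suc n} m≢n = ≡ᵇ≡false (m≢n ∘ cong suc)

∨-∧-not≡xor : ∀ x y → (x ∧ not y) ∨ (not x ∧ y) ≡ x xor y
∨-∧-not≡xor true  true  = refl
∨-∧-not≡xor true  false = refl
∨-∧-not≡xor false true  = refl
∨-∧-not≡xor false false = refl

length-∷ʳ : ∀ {A : Set} (u : List A) x → length (u ∷ʳ x) ≡ suc (length u)
length-∷ʳ u x = trans (length-++ u {x ∷ []}) (+-comm (length u) 1)

reverse-∷ʳ : ∀ {A : Set} (u : List A) x → reverse (u ∷ʳ x) ≡ x ∷ reverse u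
reverse-∷ʳ u x = reverse-++ u (x ∷ [])

∈-∷ʳ⁻ : ∀ {A : Set} {u : List A} {x y} → y ∈ u ∷ʳ x → y ≢ x → y ∈ u
∈-∷ʳ⁻ {u = u} y∈ y≢x with ∈-++⁻ u y∈
... | inj₁ y∈u        = y∈u
... | inj₂ (here y≡x) = contradiction y≡x y≢x

applyUpTo-cong : ∀ {A : Set} {f g : ℕ → A} n → (∀ {j} → j < n → f j ≡ g j) →
                 applyUpTo f n ≡ applyUpTo g n
applyUpTo-cong zero    _   = refl
applyUpTo-cong (suc n) f≗g = cong₂ _∷_ (f≗g z<s) (applyUpTo-cong n (f≗g ∘ s<s))

∉-bounded : ∀ {k} {u : List ℕ} → All (_< k) u → k ∉ u
∉-bounded u<k k∈u = <-irrefl refl (All.lookup u<k k∈u)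

0∉map-suc : ∀ u → 0 ∉ map suc u
0∉map-suc u 0∈ with ∈-map⁻ suc 0∈
... | _ , _ , ()

map-suc-pred : ∀ {w} → 0 ∉ w → map suc (map pred w) ≡ w
map-suc-pred {[]}        _   = refl
map-suc-pred {zero ∷ w}  0∉w = contradiction (here refl) 0∉w
map-suc-pred {suc x ∷ w} 0∉w = cong (suc x ∷_) (map-suc-pred (0∉w ∘ there))

Unique-∷ʳ⁺ : ∀ {u : List ℕ} {x} → Unique u → x ∉ u → Unique (u ∷ʳ x)
Unique-∷ʳ⁺ u! x∉u = Unique.++⁺ u! ([] ∷ []) λ { (x∈u , here refl) → x∉u x∈u }

Unique-∷ʳ⁻ : ∀ (u : List ℕ) {x} → Unique (u ∷ʳ x) → Unique u × x ∉ u
Unique-∷ʳ⁻ []      _          = [] , λ ()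
Unique-∷ʳ⁻ (y ∷ u) (y∉ ∷ u!) with All.∷ʳ⁻ y∉ | Unique-∷ʳ⁻ u u!
... | y∉u , y≢x | u!′ , x∉u =
  y∉u ∷ u!′ , λ { (here x≡y) → y≢x (sym x≡y) ; (there x∈u) → x∉u x∈u }

pos-∷ʳ : ∀ {j} u x → j ∈ u → pos j (u ∷ʳ x) ≡ pos j u
pos-∷ʳ     (y ∷ u) x (here refl) rewrite ≡ᵇ≡true y = refl
pos-∷ʳ {j} (y ∷ u) x (there j∈u) with y ≡ᵇ j
... | true  = refl
... | false = cong suc (pos-∷ʳ u x j∈u)

pos<length : ∀ {j} u → j ∈ u → pos j u < length u
pos<length     (y ∷ u) (here refl) rewrite ≡ᵇ≡true y = z<s
pos<length {j} (y ∷ u) (there j∈u) with y ≡ᵇ j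
... | true  = z<s
... | false = s<s (pos<length u j∈u)

pos-∷ʳ-∉ : ∀ {j} u → j ∉ u → pos j (u ∷ʳ j) ≡ length u
pos-∷ʳ-∉ {j} []      _   rewrite ≡ᵇ≡true j = refl
pos-∷ʳ-∉ {j} (y ∷ u) j∉u rewrite ≡ᵇ≡false {y} {j} (j∉u ∘ here ∘ sym) =
  cong suc (pos-∷ʳ-∉ u (j∉u ∘ there))

pos-∷ʳ-< : ∀ {j x} u → j ∈ u → x ∉ u → pos j (u ∷ʳ x) < pos x (u ∷ʳ x)
pos-∷ʳ-< u j∈u x∉u = subst₂ _<_ (sym (pos-∷ʳ u _ j∈u)) (sym (pos-∷ʳ-∉ u x∉u)) (pos<length u j∈u)

pos-map-suc : ∀ j u → pos (suc j) (map suc u) ≡ pos j u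
pos-map-suc j []      = refl
pos-map-suc j (y ∷ u) with y ≡ᵇ j
... | true  = refl
... | false = cong suc (pos-map-suc j u)

pkW-∷⁻ : ∀ a l → pkW (a ∷ l) ≡ 0 → pkW l ≡ 0
pkW-∷⁻ a []          _ = refl
pkW-∷⁻ a (b ∷ [])    _ = refl
pkW-∷⁻ a (b ∷ c ∷ r) h = m+n≡0⇒n≡0 (b2n ((a <ᵇ b) ∧ (c <ᵇ b))) h

pkW-∷ʳ-max : ∀ {a} l → All (_< a) l → pkW (l ∷ʳ a) ≡ pkW l
pkW-∷ʳ-max []              _ = refl
pkW-∷ʳ-max (p ∷ [])        _ = refl
pkW-∷ʳ-max (p ∷ q ∷ [])    (_ ∷ q<a ∷ []) rewrite <ᵇ≡false (<⇒≤ q<a) | ∧-zeroʳ (p <ᵇ q) = refl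
pkW-∷ʳ-max (p ∷ q ∷ r ∷ l) (_ ∷ q∷r∷l<a) =
  cong (b2n ((p <ᵇ q) ∧ (r <ᵇ q)) +_) (pkW-∷ʳ-max (q ∷ r ∷ l) q∷r∷l<a)

pkW-∷-max : ∀ {a} l → All (_< a) l → pkW (a ∷ l) ≡ pkW l
pkW-∷-max []          _         = refl
pkW-∷-max (p ∷ [])    _         = refl
pkW-∷-max (p ∷ q ∷ r) (p<a ∷ _) rewrite <ᵇ≡false (<⇒≤ p<a) = refl

peak⇒pkW≢0 : ∀ {a b c} r → a < b → c < b → pkW (a ∷ b ∷ c ∷ r) ≢ 0
peak⇒pkW≢0 r a<b c<b rewrite <ᵇ≡true a<b | <ᵇ≡true c<b = λ ()

applyUpTo-peak⇒pkW≢0 : ∀ (f : ℕ → ℕ) n x → 2 + x < n → f x < f (1 + x) → f (2 + x) < f (1 + x) →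
                       pkW (applyUpTo f n) ≢ 0
applyUpTo-peak⇒pkW≢0 f (suc (suc zero))    zero    (s≤s (s≤s ()))
applyUpTo-peak⇒pkW≢0 f (suc (suc (suc n))) zero    _ = peak⇒pkW≢0 (applyUpTo (f ∘ suc ∘ suc ∘ suc) n)
applyUpTo-peak⇒pkW≢0 f (suc n)             (suc x) (s<s 2+x<n) up down =
  applyUpTo-peak⇒pkW≢0 (f ∘ suc) n x 2+x<n up down ∘ pkW-∷⁻ (f 0) (applyUpTo (f ∘ suc) n)

record Permutation (n : ℕ) (w : List ℕ) : Set where
  field
    length≡ : length w ≡ n
    unique  : Unique w
    covers  : ∀ {j} → j < n → j ∈ w
    bounded : All (_< n) w
open Permutation

Permutation1⇒≡[0] : ∀ {w} → Permutation 1 w → w ≡ 0 ∷ []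
Permutation1⇒≡[0] {[]}        P with () ← length≡ P
Permutation1⇒≡[0] {_ ∷ _ ∷ _} P with () ← length≡ P
Permutation1⇒≡[0] {x ∷ []}    P with All.head (bounded P)
... | z<s = refl

∷ʳ-max⁺ : ∀ {k u} → Permutation k u → Permutation (suc k) (u ∷ʳ k)
∷ʳ-max⁺ {k} {u} P = record
  { length≡ = trans (length-∷ʳ u k) (cong suc (length≡ P))
  ; unique  = Unique-∷ʳ⁺ (unique P) (∉-bounded (bounded P))
  ; covers  = covers′
  ; bounded = All.∷ʳ⁺ (All.map (λ j<k → <-trans j<k (n<1+n k)) (bounded P)) (n<1+n k)
  }
  where
  covers′ : ∀ {j} → j < suc k → j ∈ u ∷ʳ k
  covers′ j<1+k with m<1+n⇒m<n∨m≡n j<1+k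
  ... | inj₁ j<k  = ∈-++⁺ˡ (covers P j<k)
  ... | inj₂ refl = ∈-++⁺ʳ u (here refl)

∷ʳ-max⁻ : ∀ {k u} → Permutation (suc k) (u ∷ʳ k) → Permutation k u
∷ʳ-max⁻ {k} {u} P = record
  { length≡ = suc-injective (trans (sym (length-∷ʳ u k)) (length≡ P))
  ; unique  = u!
  ; covers  = λ j<k → ∈-∷ʳ⁻ (covers P (<-trans j<k (n<1+n k))) (<⇒≢ j<k)
  ; bounded = All.tabulate λ j∈u →
      ≤∧≢⇒< (s≤s⁻¹ (All.lookup (bounded P) (∈-++⁺ˡ j∈u))) λ { refl → k∉u j∈u }
  }
  where
  u!  = proj₁ (Unique-∷ʳ⁻ u (unique P))
  k∉u = proj₂ (Unique-∷ʳ⁻ u (unique P))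

∷ʳ-min⁺ : ∀ {k u} → Permutation k u → Permutation (suc k) (map suc u ∷ʳ 0)
∷ʳ-min⁺ {k} {u} P = record
  { length≡ = trans (length-∷ʳ (map suc u) 0) (cong suc (trans (length-map suc u) (length≡ P)))
  ; unique  = Unique-∷ʳ⁺ (Unique.map⁺ suc-injective (unique P)) (0∉map-suc u)
  ; covers  = covers′
  ; bounded = All.∷ʳ⁺ (All.map⁺ (All.map s<s (bounded P))) z<s
  }
  where
  covers′ : ∀ {j} → j < suc k → j ∈ map suc u ∷ʳ 0
  covers′ {zero}  _         = ∈-++⁺ʳ (map suc u) (here refl)
  covers′ {suc j} (s<s j<k) = ∈-++⁺ˡ (∈-map⁺ suc (covers P j<k))

∷ʳ-min⁻ : ∀ {k w} → Permutation (suc k) (w ∷ʳ 0) →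
          Σ (List ℕ) λ u → map suc u ≡ w × Permutation k u
∷ʳ-min⁻ {k} {w} P = map pred w , w≡ , record
  { length≡ = trans (length-map pred w) (suc-injective (trans (sym (length-∷ʳ w 0)) (length≡ P)))
  ; unique  = Unique.map⁻ (subst Unique (sym w≡) w!)
  ; covers  = λ j<k → ∈-map⁺ pred (∈-∷ʳ⁻ (covers P (s<s j<k)) λ ())
  ; bounded = All.map s<s⁻¹ (All.map⁻ (subst (All (_< suc k)) (sym w≡) (proj₁ (All.∷ʳ⁻ (bounded P)))))
  }
  where
  w!  = proj₁ (Unique-∷ʳ⁻ w (unique P))
  w≡  = map-suc-pred (proj₂ (Unique-∷ʳ⁻ w (unique P)))

invWord-bounded : ∀ {k u} → Permutation k u → All (_< k) (invWord k u)
invWord-bounded {k} {u} P = subst (All (_< k)) (sym (map-upTo _ k))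
  (All.applyUpTo⁺₁ _ k λ j<k → subst (_ <_) (length≡ P) (pos<length u (covers P j<k)))

invWord-∷ʳ-max : ∀ {k u} → Permutation k u → invWord (suc k) (u ∷ʳ k) ≡ invWord k u ∷ʳ k
invWord-∷ʳ-max {k} {u} P = begin
  invWord (suc k) (u ∷ʳ k)
    ≡⟨ map-upTo _ (suc k) ⟩
  applyUpTo (λ j → pos j (u ∷ʳ k)) (suc k)
    ≡⟨ applyUpTo-∷ʳ _ k ⟨
  applyUpTo (λ j → pos j (u ∷ʳ k)) k ∷ʳ pos k (u ∷ʳ k)
    ≡⟨ cong₂ _∷ʳ_ (applyUpTo-cong k (pos-∷ʳ u k ∘ covers P))
                  (trans (pos-∷ʳ-∉ u (∉-bounded (bounded P))) (length≡ P)) ⟩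
  applyUpTo (λ j → pos j u) k ∷ʳ k
    ≡⟨ cong (_∷ʳ k) (map-upTo _ k) ⟨
  invWord k u ∷ʳ k
    ∎
  where open ≡-Reasoning

invWord-∷ʳ-min : ∀ {k u} → Permutation k u → invWord (suc k) (map suc u ∷ʳ 0) ≡ k ∷ invWord k u
invWord-∷ʳ-min {k} {u} P = begin
  invWord (suc k) (map suc u ∷ʳ 0)
    ≡⟨ map-upTo _ (suc k) ⟩
  pos 0 (map suc u ∷ʳ 0) ∷ applyUpTo (λ j → pos (suc j) (map suc u ∷ʳ 0)) k
    ≡⟨ cong₂ _∷_ (trans (pos-∷ʳ-∉ (map suc u) (0∉map-suc u)) (trans (length-map suc u) (length≡ P)))
                 (applyUpTo-cong k λ j<k → trans (pos-∷ʳ (map suc u) 0 (∈-map⁺ suc (covers P j<k)))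
                                                 (pos-map-suc _ u)) ⟩
  k ∷ applyUpTo (λ j → pos j u) k
    ≡⟨ cong (k ∷_) (map-upTo _ k) ⟨
  k ∷ invWord k u
    ∎
  where open ≡-Reasoning

ipk-∷ʳ-max : ∀ {k u} → Permutation k u → pkW (invWord (suc k) (u ∷ʳ k)) ≡ pkW (invWord k u)
ipk-∷ʳ-max P = trans (cong pkW (invWord-∷ʳ-max P)) (pkW-∷ʳ-max _ (invWord-bounded P))

ipk-∷ʳ-min : ∀ {k u} → Permutation k u → pkW (invWord (suc k) (map suc u ∷ʳ 0)) ≡ pkW (invWord k u)
ipk-∷ʳ-min P = trans (cong pkW (invWord-∷ʳ-min P)) (pkW-∷-max _ (invWord-bounded P))

-- Otherwise x - 1 and x + 1 both occur before x: a peak of the inverse at x.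
ipk≡0⇒last-extreme : ∀ {m u x} → Permutation (suc (suc m)) (u ∷ʳ x) →
                     pkW (invWord (suc (suc m)) (u ∷ʳ x)) ≡ 0 → x ≡ 0 ⊎ x ≡ suc m
ipk≡0⇒last-extreme {x = zero} _ _ = inj₁ refl
ipk≡0⇒last-extreme {m} {u} {suc y} P ipk≡0 with suc y ≟ suc m
... | yes 1+y≡1+m = inj₂ 1+y≡1+m
... | no  1+y≢1+m = contradiction (trans (cong pkW (sym (map-upTo f (2 + m)))) ipk≡0)
                      (applyUpTo-peak⇒pkW≢0 f (2 + m) y 2+y<2+m
                        (before (<-trans (n<1+n y) 1+y<2+m) (<⇒≢ (n<1+n y)))
                        (before 2+y<2+m (1+n≢n {suc y})))
  where
  f : ℕ → ℕ
  f j = pos j (u ∷ʳ suc y)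
  1+y<2+m : suc y < 2 + m
  1+y<2+m = All.lookup (bounded P) (∈-++⁺ʳ u (here refl))
  2+y<2+m : 2 + y < 2 + m
  2+y<2+m = s<s (≤∧≢⇒< (s<s⁻¹ 1+y<2+m) 1+y≢1+m)
  before : ∀ {j} → j < 2 + m → j ≢ suc y → f j < f (suc y)
  before j<2+m j≢1+y = pos-∷ʳ-< u (∈-∷ʳ⁻ (covers P j<2+m) j≢1+y) (proj₂ (Unique-∷ʳ⁻ u (unique P)))

ascentsFrom : ℕ → List ℕ → List Bool
ascentsFrom x []      = []
ascentsFrom x (y ∷ l) = (x <ᵇ y) ∷ ascentsFrom y l

ascents : List ℕ → List Bool
ascents []      = []
ascents (x ∷ l) = ascentsFrom x l

length-ascents : ∀ w → length (ascents w) ≡ pred (length w)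
length-ascents []      = refl
length-ascents (x ∷ l) = go x l
  where
  go : ∀ x l → length (ascentsFrom x l) ≡ length l
  go x []      = refl
  go x (y ∷ l) = cong suc (go y l)

ascents-map-suc : ∀ w → ascents (map suc w) ≡ ascents w
ascents-map-suc []      = refl
ascents-map-suc (x ∷ l) = go x l
  where
  go : ∀ x l → ascentsFrom (suc x) (map suc l) ≡ ascentsFrom x l
  go x []      = refl
  go x (y ∷ l) = cong ((x <ᵇ y) ∷_) (go y l)

ascents-∷ʳ : ∀ {b z n} w → length w ≡ suc n → All (λ y → (y <ᵇ z) ≡ b) w →
             ascents (w ∷ʳ z) ≡ ascents w ∷ʳ b
ascents-∷ʳ (x ∷ l) _ = go x l
  where
  go : ∀ {b z} x l → All (λ y → (y <ᵇ z) ≡ b) (x ∷ l) →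
       ascentsFrom x (l ∷ʳ z) ≡ ascentsFrom x l ∷ʳ b
  go x []      (x<ᵇz ∷ [])   = cong (_∷ []) x<ᵇz
  go x (y ∷ l) (_ ∷ y∷l<ᵇz) = cong ((x <ᵇ y) ∷_) (go y l y∷l<ᵇz)

ascents-∷ʳ-max : ∀ {k u} → Permutation (suc k) u → ascents (u ∷ʳ suc k) ≡ ascents u ∷ʳ true
ascents-∷ʳ-max P = ascents-∷ʳ _ (length≡ P) (All.map <ᵇ≡true (bounded P))

ascents-∷ʳ-min : ∀ {k u} → Permutation (suc k) u → ascents (map suc u ∷ʳ 0) ≡ ascents u ∷ʳ false
ascents-∷ʳ-min {u = u} P =
  trans (ascents-∷ʳ {z = 0} (map suc u) (trans (length-map suc u) (length≡ P)) (All.universal (λ _ → refl) _))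
        (cong (_∷ʳ false) (ascents-map-suc u))

length-reverse-ascents : ∀ {k u} → Permutation (suc k) u → length (reverse (ascents u)) ≡ k
length-reverse-ascents {u = u} P =
  trans (length-reverse (ascents u)) (trans (length-ascents u) (cong pred (length≡ P)))

-- s lists the steps latest first, hence the reversals below.
grow : List Bool → List ℕ
grow []          = 0 ∷ []
grow (true  ∷ s) = grow s ∷ʳ suc (length s)
grow (false ∷ s) = map suc (grow s) ∷ʳ 0

grow-permutation : ∀ {n} s → length s ≡ n → Permutation (suc n) (grow s)
grow-permutation []          refl = record
  { length≡ = refl ; unique = [] ∷ [] ; covers = λ { z<s → here refl } ; bounded = z<s ∷ [] }
grow-permutation (true  ∷ s) refl = ∷ʳ-max⁺ (grow-permutation s refl)
grow-permutation (false ∷ s) refl = ∷ʳ-min⁺ (grow-permutation s refl)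

ipk-grow : ∀ {n} s → length s ≡ n → pkW (invWord (suc n) (grow s)) ≡ 0
ipk-grow []          refl = refl
ipk-grow (true  ∷ s) refl = trans (ipk-∷ʳ-max (grow-permutation s refl)) (ipk-grow s refl)
ipk-grow (false ∷ s) refl = trans (ipk-∷ʳ-min (grow-permutation s refl)) (ipk-grow s refl)

ascents-grow : ∀ s → ascents (grow s) ≡ reverse s
ascents-grow []          = refl
ascents-grow (true  ∷ s) = trans (ascents-∷ʳ-max (grow-permutation s refl))
                                 (trans (cong (_∷ʳ true) (ascents-grow s)) (sym (unfold-reverse true s)))
ascents-grow (false ∷ s) = trans (ascents-∷ʳ-min (grow-permutation s refl))
                                 (trans (cong (_∷ʳ false) (ascents-grow s)) (sym (unfold-reverse false s)))

grow-ascents-∷ʳ-max : ∀ {k u} → Permutation (suc k) u → grow (reverse (ascents u)) ≡ u →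
                      grow (reverse (ascents (u ∷ʳ suc k))) ≡ u ∷ʳ suc k
grow-ascents-∷ʳ-max {k} {u} P grow-u = begin
  grow (reverse (ascents (u ∷ʳ suc k)))  ≡⟨ cong (grow ∘ reverse) (ascents-∷ʳ-max P) ⟩
  grow (reverse (ascents u ∷ʳ true))     ≡⟨ cong grow (reverse-∷ʳ (ascents u) true) ⟩
  grow (true ∷ reverse (ascents u))      ≡⟨ cong₂ _∷ʳ_ grow-u (cong suc (length-reverse-ascents P)) ⟩
  u ∷ʳ suc k                             ∎
  where open ≡-Reasoning

grow-ascents-∷ʳ-min : ∀ {k u} → Permutation (suc k) u → grow (reverse (ascents u)) ≡ u →
                      grow (reverse (ascents (map suc u ∷ʳ 0))) ≡ map suc u ∷ʳ 0
grow-ascents-∷ʳ-min {k} {u} P grow-u = begin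
  grow (reverse (ascents (map suc u ∷ʳ 0)))  ≡⟨ cong (grow ∘ reverse) (ascents-∷ʳ-min P) ⟩
  grow (reverse (ascents u ∷ʳ false))        ≡⟨ cong grow (reverse-∷ʳ (ascents u) false) ⟩
  grow (false ∷ reverse (ascents u))         ≡⟨ cong (λ w → map suc w ∷ʳ 0) grow-u ⟩
  map suc u ∷ʳ 0                             ∎
  where open ≡-Reasoning

grow-ascents : ∀ {m w} → Permutation (suc m) w → pkW (invWord (suc m) w) ≡ 0 →
               grow (reverse (ascents w)) ≡ w
grow-ascents {zero}  P _ with refl ← Permutation1⇒≡[0] P = refl
grow-ascents {suc m} {w} P ipk≡0 with initLast w
... | u ∷ʳ′ x with ipk≡0⇒last-extreme P ipk≡0
...   | inj₂ refl = grow-ascents-∷ʳ-max P′ (grow-ascents P′ (trans (sym (ipk-∷ʳ-max P′)) ipk≡0))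
  where P′ = ∷ʳ-max⁻ P
...   | inj₁ refl with ∷ʳ-min⁻ P
...     | u′ , refl , P′ = grow-ascents-∷ʳ-min P′ (grow-ascents P′ (trans (sym (ipk-∷ʳ-min P′)) ipk≡0))

switches : Bool → List Bool → ℕ
switches c []      = 0
switches c (b ∷ s) = b2n (c xor b) + switches b s

turn≡xor : ∀ {a b c} → a ≢ b → b ≢ c →
           (((a <ᵇ b) ∧ (c <ᵇ b)) ∨ ((b <ᵇ a) ∧ (b <ᵇ c))) ≡ (a <ᵇ b) xor (b <ᵇ c)
turn≡xor {a} {b} {c} a≢b b≢c rewrite <ᵇ-flip a≢b | <ᵇ-flip b≢c = ∨-∧-not≡xor (a <ᵇ b) (b <ᵇ c)

turnW≡switches : ∀ a b r → Unique (a ∷ b ∷ r) →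
                 turnW (a ∷ b ∷ r) ≡ switches (a <ᵇ b) (ascentsFrom b r)
turnW≡switches a b []      _ = refl
turnW≡switches a b (c ∷ r) ((a≢b ∷ _) ∷ b∷r!@((b≢c ∷ _) ∷ _)) =
  cong₂ _+_ (cong b2n (turn≡xor a≢b b≢c)) (turnW≡switches b c r b∷r!)

-- An initial descent π(1) > π(2) is a switch away from a virtual initial ascent;
-- it accounts for the extra up-down run π(1).
udr-ascents : ∀ {n w} → Permutation (suc n) w → udrW w ≡ suc (switches true (ascents w))
udr-ascents {w = w} P = go w (length≡ P) (unique P)
  where
  go : ∀ {n} w → length w ≡ suc n → Unique w → udrW w ≡ suc (switches true (ascents w))
  go (a ∷ [])    _ _                  = refl
  go (a ∷ b ∷ r) _ w!@((a≢b ∷ _) ∷ _) = begin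
    b2n (b <ᵇ a) + suc (turnW (a ∷ b ∷ r))
      ≡⟨ +-suc (b2n (b <ᵇ a)) _ ⟩
    suc (b2n (b <ᵇ a) + turnW (a ∷ b ∷ r))
      ≡⟨ cong suc (cong₂ _+_ (cong b2n (<ᵇ-flip a≢b)) (turnW≡switches a b r w!)) ⟩
    suc (b2n (not (a <ᵇ b)) + switches (a <ᵇ b) (ascentsFrom b r))
      ∎
    where open ≡-Reasoning

Words : ℕ → Bool → ℕ → Set
Words m c j = Σ (List Bool) λ s → length s ≡ m × switches c s ≡ j

Words-≡ : ∀ {m c j} {w w′ : Words m c j} → proj₁ w ≡ proj₁ w′ → w ≡ w′
Words-≡ {w = s , p , q} {.s , p′ , q′} refl =
  cong₂ (λ p q → s , p , q) (≡-irrelevant p p′) (≡-irrelevant q q′)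

Words-suc-zero : ∀ {m} c → Words (suc m) c 0 ↔ Words m c 0
Words-suc-zero {m} c = mk↔ₛ′ (to c) (from c) (to∘from c) (from∘to c)
  where
  to : ∀ c → Words (suc m) c 0 → Words m c 0
  to true  (true  ∷ s , len , sw) = s , suc-injective len , sw
  to false (false ∷ s , len , sw) = s , suc-injective len , sw
  to true  (false ∷ _ , _ , ())
  to false (true  ∷ _ , _ , ())
  from : ∀ c → Words m c 0 → Words (suc m) c 0
  from true  (s , len , sw) = true  ∷ s , cong suc len , sw
  from false (s , len , sw) = false ∷ s , cong suc len , sw
  to∘from : ∀ c w → to c (from c w) ≡ w
  to∘from true  _ = Words-≡ refl
  to∘from false _ = Words-≡ refl
  from∘to : ∀ c w → from c (to c w) ≡ w
  from∘to true  (true  ∷ _ , _) = Words-≡ refl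
  from∘to false (false ∷ _ , _) = Words-≡ refl
  from∘to true  (false ∷ _ , _ , ())
  from∘to false (true  ∷ _ , _ , ())

Words-suc-suc : ∀ {m j} c → Words (suc m) c (suc j) ↔ (Words m (not c) j ⊎ Words m c (suc j))
Words-suc-suc {m} {j} c = mk↔ₛ′ (to c) (from c) (to∘from c) (from∘to c)
  where
  to : ∀ c → Words (suc m) c (suc j) → Words m (not c) j ⊎ Words m c (suc j)
  to true  (false ∷ s , len , sw) = inj₁ (s , suc-injective len , suc-injective sw)
  to false (true  ∷ s , len , sw) = inj₁ (s , suc-injective len , suc-injective sw)
  to true  (true  ∷ s , len , sw) = inj₂ (s , suc-injective len , sw)
  to false (false ∷ s , len , sw) = inj₂ (s , suc-injective len , sw)
  from : ∀ c → Words m (not c) j ⊎ Words m c (suc j) → Words (suc m) c (suc j)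
  from true  (inj₁ (s , len , sw)) = false ∷ s , cong suc len , cong suc sw
  from false (inj₁ (s , len , sw)) = true  ∷ s , cong suc len , cong suc sw
  from true  (inj₂ (s , len , sw)) = true  ∷ s , cong suc len , sw
  from false (inj₂ (s , len , sw)) = false ∷ s , cong suc len , sw
  to∘from : ∀ c w → to c (from c w) ≡ w
  to∘from true  (inj₁ _) = cong inj₁ (Words-≡ refl)
  to∘from false (inj₁ _) = cong inj₁ (Words-≡ refl)
  to∘from true  (inj₂ _) = cong inj₂ (Words-≡ refl)
  to∘from false (inj₂ _) = cong inj₂ (Words-≡ refl)
  from∘to : ∀ c w → from c (to c w) ≡ w
  from∘to true  (false ∷ _ , _) = Words-≡ refl
  from∘to false (true  ∷ _ , _) = Words-≡ refl
  from∘to true  (true  ∷ _ , _) = Words-≡ refl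
  from∘to false (false ∷ _ , _) = Words-≡ refl

Words↔binomial : ∀ m c j → Words m c j ↔ Fin (m C j)
Words↔binomial zero    c zero    = mk↔ₛ′ (λ _ → Fin.zero) (λ _ → [] , refl , refl)
                                     (λ { Fin.zero → refl ; (Fin.suc ()) }) (λ { ([] , refl , refl) → refl })
Words↔binomial zero    c (suc j) = mk↔ₛ′ (λ { ([] , _ , ()) }) (λ ()) (λ ()) (λ { ([] , _ , ()) })
Words↔binomial (suc m) c zero    = ↔-trans (Words-suc-zero c) (Words↔binomial m c zero)
Words↔binomial (suc m) c (suc j) =
  ↔-trans (Words-suc-suc c) $
  ↔-trans (Words↔binomial m (not c) j ⊎-↔ Words↔binomial m c (suc j)) $
  subst (λ n → (Fin (m C j) ⊎ Fin (m C suc j)) ↔ Fin n) (nCk+nC[k+1]≡[n+1]C[k+1] m j) (↔-sym +↔⊎)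

Unique-toList⁻ : ∀ {A : Set} {n} {xs : Vec A n} → Unique (toList xs) → VecUnique.Unique xs
Unique-toList⁻ {xs = Vec.[]}     []         = VecUnique.[]
Unique-toList⁻ {xs = x Vec.∷ xs} (x∉ ∷ xs!) = VecAll.toList⁻ x∉ VecUnique.∷ Unique-toList⁻ xs!

-- Otherwise punching i out of the entries gives an injection Fin (suc n) → Fin n.
Unique⇒complete : ∀ {n} {xs : Vec (Fin n) n} → VecUnique.Unique xs → ∀ i → i ∈ᵥ xs
Unique⇒complete {suc n} {xs} xs! i with any? (i Fin.≟_) xs
... | yes i∈xs = i∈xs
... | no  i∉xs = contradiction (injective⇒≤ {f = f} f-injective) 1+n≰n
  where
  f : Fin (suc n) → Fin n
  f k = punchOut {i = i} {j = lookup xs k} λ i≡xsₖ → i∉xs (subst (_∈ᵥ xs) (sym i≡xsₖ) (∈-lookup k xs))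
  f-injective : Injective _≡_ _≡_ f
  f-injective eq = lookup-injective xs! _ _ (punchOut-injective {i = i} _ _ eq)

word≡map : ∀ {n} (v : Vec (Fin n) n) → word v ≡ map toℕ (toList v)
word≡map v = toList-map toℕ v

word-injective : ∀ {n} {v v′ : Vec (Fin n) n} → word v ≡ word v′ → v ≡ v′
word-injective {v = v} {v′} eq =
  trans (sym (cast-is-id refl v)) $ toList-injective refl v v′ $
  map-injective toℕ-injective (trans (sym (word≡map v)) (trans eq (word≡map v′)))

word-permutation : ∀ {n} (v : Vec (Fin n) n) → T (isPerm v) → Permutation n (word v)
word-permutation {n} v isPerm-v = record
  { length≡ = length-toList (Vec.map toℕ v)
  ; unique  = subst Unique (sym (word≡map v)) (Unique.map⁺ toℕ-injective v!)
  ; covers  = λ j<n → subst (_∈ word v) (toℕ-fromℕ< j<n) (subst (_ ∈_) (sym (word≡map v))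
                (∈-map⁺ toℕ (∈-toList⁺ (Unique⇒complete (Unique-toList⁻ v!) _))))
  ; bounded = subst (All (_< n)) (sym (word≡map v)) (All.map⁺ (All.universal toℕ<n (toList v)))
  }
  where v! = toWitness isPerm-v

fromWord : ∀ {N n} (w : List ℕ) → length w ≡ n → All (_< N) w → Vec (Fin N) n
fromWord []      refl []          = Vec.[]
fromWord (x ∷ w) refl (x<N ∷ w<N) = fromℕ< x<N Vec.∷ fromWord w refl w<N

toList-map-fromWord : ∀ {N n} w (eq : length w ≡ n) (w<N : All (_< N) w) →
                      toList (Vec.map toℕ (fromWord w eq w<N)) ≡ w
toList-map-fromWord []      refl []          = refl
toList-map-fromWord (x ∷ w) refl (x<N ∷ w<N) = cong₂ _∷_ (toℕ-fromℕ< x<N) (toList-map-fromWord w refl w<N)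

toVec : ∀ {n w} → Permutation n w → Vec (Fin n) n
toVec {w = w} P = fromWord w (length≡ P) (bounded P)

word-toVec : ∀ {n w} (P : Permutation n w) → word (toVec P) ≡ w
word-toVec {w = w} P = toList-map-fromWord w (length≡ P) (bounded P)

isPerm-toVec : ∀ {n w} (P : Permutation n w) → T (isPerm (toVec P))
isPerm-toVec P =
  fromWitness (Unique.map⁻ (subst Unique (trans (sym (word-toVec P)) (word≡map (toVec P))) (unique P)))

Counted-conditions : ∀ {n k} (v : Vec (Fin n) n) →
               T (isPerm v ∧ (udr v ≡ᵇ k) ∧ (ipk v ≡ᵇ 0)) ⇔ (T (isPerm v) × udr v ≡ k × ipk v ≡ 0)
Counted-conditions {n} {k} v = mk⇔
  (λ t → let isPerm-v , t′ = Equivalence.to (T-∧ {isPerm v}) t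
             udr≡ , ipk≡   = Equivalence.to (T-∧ {udr v ≡ᵇ k}) t′
         in isPerm-v , ≡ᵇ⇒≡ _ _ udr≡ , ≡ᵇ⇒≡ _ _ ipk≡)
  (λ { (isPerm-v , udr≡ , ipk≡) →
         Equivalence.from T-∧ (isPerm-v ,
           Equivalence.from T-∧ (≡⇒≡ᵇ _ _ udr≡ , ≡⇒≡ᵇ _ _ ipk≡)) })

Counted-≡ : ∀ {n k} {c c′ : Counted n k} → proj₁ c ≡ proj₁ c′ → c ≡ c′
Counted-≡ {c = v , t} {.v , t′} refl = cong (v ,_) (T-irrelevant t t′)

¬Counted-udr≡0 : ∀ {m} → ¬ Counted (suc m) 0
¬Counted-udr≡0 (v , t) with isPerm-v , udr≡0 , _ ← Equivalence.to (Counted-conditions v) t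
  with () ← trans (sym (udr-ascents (word-permutation v isPerm-v))) udr≡0

Counted↔Words : ∀ m k → Counted (suc m) (suc k) ↔ Words m true k
Counted↔Words m k = mk↔ₛ′ to from (λ w → Words-≡ (From.ascents-word w)) from∘to
  where
  to : Counted (suc m) (suc k) → Words m true k
  to (v , t) = ascents (word v) , trans (length-ascents (word v)) (cong pred (length≡ P)) ,
               suc-injective (trans (sym (udr-ascents P)) udr≡)
    where
    spec = Equivalence.to (Counted-conditions v) t
    P    = word-permutation v (proj₁ spec)
    udr≡ = proj₁ (proj₂ spec)

  module From (w : Words m true k) where
    s : List Bool
    s = proj₁ w
    len′ : length (reverse s) ≡ m
    len′ = trans (length-reverse s) (proj₁ (proj₂ w))
    P : Permutation (suc m) (grow (reverse s))
    P = grow-permutation (reverse s) len′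
    ascents-grow-reverse : ascents (grow (reverse s)) ≡ s
    ascents-grow-reverse = trans (ascents-grow (reverse s)) (reverse-involutive s)
    ascents-word : ascents (word (toVec P)) ≡ s
    ascents-word = trans (cong ascents (word-toVec P)) ascents-grow-reverse
    udr≡ : udr (toVec P) ≡ suc k
    udr≡ = begin
      udrW (word (toVec P))                             ≡⟨ cong udrW (word-toVec P) ⟩
      udrW (grow (reverse s))                           ≡⟨ udr-ascents P ⟩
      suc (switches true (ascents (grow (reverse s))))  ≡⟨ cong (suc ∘ switches true) ascents-grow-reverse ⟩
      suc (switches true s)                             ≡⟨ cong suc (proj₂ (proj₂ w)) ⟩
      suc k                                             ∎
      where open ≡-Reasoning
    ipk≡ : ipk (toVec P) ≡ 0
    ipk≡ = trans (cong (pkW ∘ invWord (suc m)) (word-toVec P)) (ipk-grow (reverse s) len′)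

  from : Words m true k → Counted (suc m) (suc k)
  from w = toVec P , Equivalence.from (Counted-conditions (toVec P)) (isPerm-toVec P , udr≡ , ipk≡)
    where open From w

  from∘to : ∀ c → from (to c) ≡ c
  from∘to (v , t) = Counted-≡ (word-injective (trans (word-toVec (From.P (to (v , t))))
                                                     (grow-ascents P (proj₂ (proj₂ spec)))))
    where
    spec = Equivalence.to (Counted-conditions v) t
    P    = word-permutation v (proj₁ spec)

proposition5p4 : (n k : ℕ) → 1 ≤ n → Counted n k ↔ Fin (binomPrev n k)
proposition5p4 (suc m) zero    _ =
  ↔-trans (mk↔ₛ′ ¬Counted-udr≡0 (λ ()) (λ ()) (⊥-elim ∘ ¬Counted-udr≡0)) (↔-sym 0↔⊥)
proposition5p4 (suc m) (suc k) _ = ↔-trans (Counted↔Words m k) (Words↔binomial m true k)
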